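{- Let $\mathcal{A}$ be an NFA with state set $Q$, and let $\mathcal{I}$ be an $(N_I^{\mathcal{A}},N_I^{\mathcal{T}})$-quasi-forest such that for all $q,q'\in Q$, $(\mathsf{Reach}^{\mathcal{A}}_{q,q'})^{\mathcal{I}}=(\mathsf{Root}\sqcap\exists\mathcal{A}_{q,q'}.\top)^{\mathcal{I}}$. Then for all $q,q'\in Q$, $(\exists\mathcal{A}_{q,q'}.\top)^{\mathcal{I}}$ equals the union of the interpretations in $\mathcal{I}$ of the concepts (1) $\mathsf{Root}\sqcap\mathsf{Reach}^{\mathcal{A}}_{q,q'}$, (2) $\neg\mathsf{Root}\sqcap\exists(\mathcal{A}_{q,q'}\bowtie\mathcal{A}_{\mathrm{nmls}}).\top$, and (3) $\neg\mathsf{Root}\sqcap\bigsqcup_{\hat q\in Q}\exists(\mathcal{A}_{q,\hat q}\bowtie\mathcal{A}_{\mathrm{outr}}).(\mathsf{Root}\sqcap\mathsf{Reach}^{\mathcal{A}}_{\hat q,q'})$.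
   Context: Paths, simple roles and NFAs: a path in $\mathcal{I}$ is a non-empty word $\rho_1\cdots\rho_n$ over $\Delta^{\mathcal{I}}$ with consecutive elements related by some simple role (built from role names via inverse, $\cap,\cup,\setminus$). NFAs have alphabet consisting of simple roles and tests $C?$; a path realises an NFA if the NFA accepts some word $w_1r_1\cdots r_{n-1}w_n$ with $(\rho_i,\rho_{i+1})\in r_i^{\mathcal{I}}$ and all tests in $w_i$ satisfied by $\rho_i$. For states $q,q'$ of $\mathcal{A}$, $\mathcal{A}_{q,q'}$ is $\mathcal{A}$ with initial state $q$ and final state $q'$. $d\in(\exists\mathcal{A}.C)^{\mathcal{I}}$ iff some path starting at $d$ and ending in $C^{\mathcal{I}}$ realises $\mathcal{A}$; $\top$ is the universal concept. $\mathsf{Reach}^{\mathcal{A}}_{q,q'}$ ($q,q'\in Q$) are fresh concept names. Quasi-forest: with fixed $\mathsf{Root}\in N_C$, $\mathsf{child},\mathsf{edge},\mathsf{id}\in N_R$, finite $N_I^{\mathcal{A}},N_I^{\mathcal{T}}\subseteq N_I$: $\Delta^{\mathcal{I}}$ is a prefix-closed set of non-empty words over $\mathbb{N}$; $\mathsf{Root}^{\mathcal{I}}=\Delta^{\mathcal{I}}\cap\mathbb{N}=\{a^{\mathcal{I}}\mid a\in N_I\}=\{a^{\mathcal{I}}\mid a\in N_I^{\mathcal{A}}\cup N_I^{\mathcal{T}}\}$; $\mathsf{child}^{\mathcal{I}}=\{(d,d\cdot n)\in\Delta^{\mathcal{I}}\times\Delta^{\mathcal{I}}\mid n\in\mathbb{N}\}$;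 $\mathsf{edge}^{\mathcal{I}}=\bigcup_{r\in N_R}(r^{\mathcal{I}}\cup(r^-)^{\mathcal{I}})$; $\mathsf{id}^{\mathcal{I}}$ the identity; every pair in any $r^{\mathcal{I}}$ ($r\in N_R$) consists of two roots, or contains $o^{\mathcal{I}}$ for some $o\in N_I^{\mathcal{T}}$, or lies in $\mathsf{id}^{\mathcal{I}}\cup\mathsf{child}^{\mathcal{I}}\cup(\mathsf{child}^-)^{\mathcal{I}}$. Named elements: $a^{\mathcal{I}}$ for $a\in N_I$. A path is nameless if it contains no named element, and outer if it is of the form $\bar\rho d$ with $\bar\rho$ nameless and $d$ a root. For an NFA $\mathcal{B}$, $\mathcal{B}\bowtie\mathcal{A}_{\mathrm{nmls}}$ (resp. $\mathcal{B}\bowtie\mathcal{A}_{\mathrm{outr}}$) denotes an NFA which, in every such quasi-forest, is realised by exactly the nameless (resp. outer) paths that realise $\mathcal{B}$. -}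

module Defs where

open import Data.Nat using (ℕ)
open import Data.Fin using (Fin)
open import Data.Fin.Subset using (Subset; ⁅_⁆) renaming (_∈_ to _∈ₛ_)
open import Data.List using (List; []; _∷_; _++_; [_])
open import Data.List.Relation.Unary.All using (All)
open import Data.List.Membership.Propositional using (_∈_)
open import Data.Product using (Σ; ∃; _×_; _,_)
open import Data.Sum using (_⊎_)
open import Data.Empty using (⊥)
open import Relation.Nullary using (¬_)
open import Relation.Binary.PropositionalEquality using (_≡_; _≢_)
open import Function.Bundles using (_⇔_)

data SRole (NR : Set) : Set where
  rn  : NR → SRole NR
  inv : SRole NR → SRole NR
  _∩_ : SRole NR → SRole NR → SRole NR
  _∪_ : SRole NR → SRole NR → SRole NR
  _∖_ : SRole NR → SRole NR → SRole NR

mutual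
  data Concept (NC NR NI : Set) : Set where
    ⊤c  : Concept NC NR NI
    ⊥c  : Concept NC NR NI
    cn  : NC → Concept NC NR NI
    nom : NI → Concept NC NR NI
    ¬c  : Concept NC NR NI → Concept NC NR NI
    _⊓_ : Concept NC NR NI → Concept NC NR NI → Concept NC NR NI
    _⊔_ : Concept NC NR NI → Concept NC NR NI → Concept NC NR NI
    exA : NFA NC NR NI → Concept NC NR NI → Concept NC NR NI

  data Letter (NC NR NI : Set) : Set where
    rl   : SRole NR → Letter NC NR NI
    test : Concept NC NR NI → Letter NC NR NI

  -- NFA: n states (Fin n), transition relation, initial state, final states
  data NFA (NC NR NI : Set) : Set where
    nfa : (n : ℕ) → List (Fin n × Letter NC NR NI × Fin n) → Fin n → Subset n → NFA NC NR NI

module _ {NC NR NI : Set} where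

  states : NFA NC NR NI → ℕ
  states (nfa n _ _ _) = n

  sub : (A : NFA NC NR NI) → Fin (states A) → Fin (states A) → NFA NC NR NI
  sub (nfa n δ _ _) q q' = nfa n δ q ⁅ q' ⁆

  ⨆ : List (Concept NC NR NI) → Concept NC NR NI
  ⨆ [] = ⊥c
  ⨆ (C ∷ Cs) = C ⊔ ⨆ Cs

record Interp (NC NR NI : Set) : Set₁ where
  field
    Δ      : List ℕ → Set
    conc   : NC → List ℕ → Set
    conc⊆Δ : ∀ A w → conc A w → Δ w
    role   : NR → List ℕ → List ℕ → Set
    role⊆Δ : ∀ r w v → role r w v → Δ w × Δ v
    ind    : NI → List ℕ
    ind∈Δ  : ∀ a → Δ (ind a)

lastOf : {X : Set} → X → List X → X
lastOf x [] = x
lastOf x (y ∷ ys) = lastOf y ys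

module Sem {NC NR NI : Set} (I : Interp NC NR NI) where
  open Interp I

  ⟦_⟧r : SRole NR → List ℕ → List ℕ → Set
  ⟦ rn r ⟧r w v = role r w v
  ⟦ inv s ⟧r w v = ⟦ s ⟧r v w
  ⟦ s ∩ t ⟧r w v = ⟦ s ⟧r w v × ⟦ t ⟧r w v
  ⟦ s ∪ t ⟧r w v = ⟦ s ⟧r w v ⊎ ⟦ t ⟧r w v
  ⟦ s ∖ t ⟧r w v = ⟦ s ⟧r w v × ¬ ⟦ t ⟧r w v

  -- Run tst stp q ρ q' : reading along the path ρ, the automaton can go
  -- from q to q' (tests at the current element, role steps to the next).
  data Run {n : ℕ} (tst : Fin n → Fin n → List ℕ → Set)
           (stp : Fin n → Fin n → List ℕ → List ℕ → Set)
           : Fin n → List (List ℕ) → Fin n → Set where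
    done : ∀ {q w} → Run tst stp q (w ∷ []) q
    test : ∀ {q p q' w ρ} → tst q p w → Run tst stp p (w ∷ ρ) q' → Run tst stp q (w ∷ ρ) q'
    step : ∀ {q p q' w u ρ} → stp q p w u → Run tst stp p (u ∷ ρ) q' → Run tst stp q (w ∷ u ∷ ρ) q'

  stepSem : ∀ {n} → List (Fin n × Letter NC NR NI × Fin n) → Fin n → Fin n → List ℕ → List ℕ → Set
  stepSem [] q p w u = ⊥
  stepSem ((q₀ , rl s , p₀) ∷ δ) q p w u = (q₀ ≡ q × p₀ ≡ p × ⟦ s ⟧r w u) ⊎ stepSem δ q p w u
  stepSem ((_ , test _ , _) ∷ δ) q p w u = stepSem δ q p w u

  Realises' : ∀ {n} → (Fin n → Fin n → List ℕ → Set) → (Fin n → Fin n → List ℕ → List ℕ → Set)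
            → Fin n → Subset n → List (List ℕ) → Set
  Realises' tst stp i F ρ = All Δ ρ × ∃ λ f → f ∈ₛ F × Run tst stp i ρ f

  mutual
    ⟦_⟧ : Concept NC NR NI → List ℕ → Set
    ⟦ ⊤c ⟧ w = Δ w
    ⟦ ⊥c ⟧ w = ⊥
    ⟦ cn A ⟧ w = conc A w
    ⟦ nom a ⟧ w = ind a ≡ w
    ⟦ ¬c C ⟧ w = Δ w × ¬ ⟦ C ⟧ w
    ⟦ C ⊓ D ⟧ w = ⟦ C ⟧ w × ⟦ D ⟧ w
    ⟦ C ⊔ D ⟧ w = ⟦ C ⟧ w ⊎ ⟦ D ⟧ w
    ⟦ exA (nfa n δ i F) C ⟧ w =
      Σ (List (List ℕ)) λ ρ → Realises' (λ q p x → testSem δ q p x) (stepSem δ) i F (w ∷ ρ) × ⟦ C ⟧ (lastOf w ρ)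

    testSem : ∀ {n} → List (Fin n × Letter NC NR NI × Fin n) → Fin n → Fin n → List ℕ → Set
    testSem [] q p w = ⊥
    testSem ((q₀ , test C , p₀) ∷ δ) q p w = (q₀ ≡ q × p₀ ≡ p × ⟦ C ⟧ w) ⊎ testSem δ q p w
    testSem ((_ , rl _ , _) ∷ δ) q p w = testSem δ q p w

  Realises : NFA NC NR NI → List (List ℕ) → Set
  Realises (nfa n δ i F) ρ = Realises' (λ q p x → testSem δ q p x) (stepSem δ) i F ρ

  Named : List ℕ → Set
  Named x = ∃ λ a → ind a ≡ x

  Nameless : List (List ℕ) → Set
  Nameless ρ = All (λ x → ¬ Named x) ρ

  Outer : NC → List (List ℕ) → Set
  Outer Root ρ = Σ (List (List ℕ)) λ ρ̄ → Σ (List ℕ) λ d →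
    ρ ≡ ρ̄ ++ [ d ] × ρ̄ ≢ [] × Nameless ρ̄ × conc Root d

Ext : {NC NR NI : Set} → Interp NC NR NI → Concept NC NR NI → List ℕ → Set
Ext I = Sem.⟦_⟧ I

Realises : {NC NR NI : Set} → Interp NC NR NI → NFA NC NR NI → List (List ℕ) → Set
Realises I = Sem.Realises I

Nameless : {NC NR NI : Set} → Interp NC NR NI → List (List ℕ) → Set
Nameless I = Sem.Nameless I

Outer : {NC NR NI : Set} → Interp NC NR NI → NC → List (List ℕ) → Set
Outer I = Sem.Outer I

record QuasiForest {NC NR NI : Set} (I : Interp NC NR NI) (Root : NC) (child edge idR : NR)
                   (NIA NIT : List NI) : Set where
  field
    nonempty   : ∀ w → Interp.Δ I w → w ≢ []
    prefix     : ∀ u v → u ≢ [] → Interp.Δ I (u ++ v) → Interp.Δ I u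
    root-words : ∀ w → Interp.conc I Root w ⇔ (Interp.Δ I w × ∃ λ n → w ≡ [ n ])
    root-named : ∀ w → Interp.conc I Root w ⇔ (∃ λ a → Interp.ind I a ≡ w)
    root-NI    : ∀ w → Interp.conc I Root w ⇔ (∃ λ a → (a ∈ NIA ⊎ a ∈ NIT) × Interp.ind I a ≡ w)
    child-def  : ∀ w v → Interp.role I child w v ⇔ (Interp.Δ I w × Interp.Δ I v × ∃ λ n → v ≡ w ++ [ n ])
    edge-def   : ∀ w v → Interp.role I edge w v ⇔ (∃ λ r → Interp.role I r w v ⊎ Interp.role I r v w)
    id-def     : ∀ w v → Interp.role I idR w v ⇔ (Interp.Δ I w × w ≡ v)
    local      : ∀ r w v → Interp.role I r w v →
                   (Interp.conc I Root w × Interp.conc I Root v)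
                   ⊎ (∃ λ o → o ∈ NIT × (Interp.ind I o ≡ w ⊎ Interp.ind I o ≡ v))
                   ⊎ Interp.role I idR w v ⊎ Interp.role I child w v ⊎ Interp.role I child v w

{-# OPTIONS --safe #-}
module Submission where

-- A path realising 𝒜_{q,q'} from a root is recorded by Reach_{q,q'}.  From a non-root w, roots are
-- exactly the named elements, so either the path never meets a named element, and then it realises
-- 𝒜_{q,q'} ⋈ 𝒜_nmls, or it first meets one at some root d in state q̂: the part up to d is an outer
-- path realising 𝒜_{q,q̂} and the rest witnesses Reach_{q̂,q'} at d.  Conversely such pieces glue back.

open import Defs
open import Data.Nat using (ℕ)
open import Data.Fin using (Fin)
open import Data.Fin.Subset.Properties using (x∈⁅x⁆; x∈⁅y⁆⇒x≡y)
open import Data.List using (List; []; _∷_; _++_; [_]; map; allFin)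
open import Data.List.Relation.Unary.All as All using (All; []; _∷_)
open import Data.List.Relation.Unary.All.Properties using (++⁺; ++⁻)
open import Data.List.Relation.Unary.Any using (Any; here; there; satisfied)
open import Data.List.Relation.Unary.Any.Properties using (map⁺; map⁻)
open import Data.List.Membership.Propositional using (lose)
open import Data.List.Membership.Propositional.Properties using (∈-allFin)
open import Data.Product using (∃; ∃₂; _×_; _,_; proj₁; proj₂)
open import Data.Sum using (_⊎_; inj₁; inj₂; [_,_]′)
import Data.Sum as Sum
open import Function using (id; _∘_)
open import Function.Bundles using (_⇔_; mk⇔; module Equivalence)
open import Relation.Nullary using (¬_; Dec; yes; no)
open import Relation.Unary using (Decidable; ∁)
open import Relation.Binary.PropositionalEquality using (_≡_; refl; sym; subst)

open Equivalence using (to; from)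

lastOf-All : ∀ {X : Set} {P : X → Set} {x xs} → All P (x ∷ xs) → P (lastOf x xs)
lastOf-All {xs = []}    (px ∷ []) = px
lastOf-All {xs = _ ∷ _} (_ ∷ pxs) = lastOf-All pxs

lastOf-∷ʳ : ∀ {X : Set} (x : X) xs y → lastOf x (xs ++ [ y ]) ≡ y
lastOf-∷ʳ x []       y = refl
lastOf-∷ʳ x (z ∷ xs) y = lastOf-∷ʳ z xs y

Singleton : List ℕ → Set
Singleton w = ∃ λ m → w ≡ [ m ]

singleton? : Decidable Singleton
singleton? []          = no λ ()
singleton? (m ∷ [])    = yes (m , refl)
singleton? (_ ∷ _ ∷ _) = no λ ()

module _ {NC NR NI : Set} (I : Interp NC NR NI) where
  open Interp I using (Δ)
  open Sem I using (Run; done; test; step; testSem; stepSem)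

  ⨆⇔Any : ∀ Cs w → Ext I (⨆ Cs) w ⇔ Any (λ C → Ext I C w) Cs
  ⨆⇔Any []       w = mk⇔ (λ ()) (λ ())
  ⨆⇔Any (C ∷ Cs) w = mk⇔ [ here , there ∘ to (⨆⇔Any Cs w) ]′ λ where
    (here e)  → inj₁ e
    (there a) → inj₂ (from (⨆⇔Any Cs w) a)

  ⨆-allFin⇔∃ : ∀ {n} (g : Fin n → Concept NC NR NI) w →
               Ext I (⨆ (map g (allFin n))) w ⇔ ∃ λ i → Ext I (g i) w
  ⨆-allFin⇔∃ {n} g w = mk⇔ (satisfied ∘ map⁻ {f = g} ∘ to (⨆⇔Any Cs w))
                            (λ (i , e) → from (⨆⇔Any Cs w) (map⁺ (lose (∈-allFin i) e)))
    where Cs = map g (allFin n)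

  exA⇔ : ∀ B C w → Ext I (exA B C) w ⇔ (∃ λ ρ → Realises I B (w ∷ ρ) × Ext I C (lastOf w ρ))
  exA⇔ (nfa _ _ _ _) C w = mk⇔ id id

  module _ {n : ℕ} {tst : Fin n → Fin n → List ℕ → Set}
           {stp : Fin n → Fin n → List ℕ → List ℕ → Set} where

    Run-++ : ∀ {q q̂ q' x} ρ {σ} → Run tst stp q (x ∷ ρ) q̂ → Run tst stp q̂ (lastOf x ρ ∷ σ) q' →
             Run tst stp q (x ∷ ρ ++ σ) q'
    Run-++ []      done       r = r
    Run-++ ρ       (test t s) r = test t (Run-++ ρ s r)
    Run-++ (_ ∷ ρ) (step t s) r = step t (Run-++ ρ s r)

    data FirstHit (P : List ℕ → Set) (q : Fin n) (x : List ℕ) : List (List ℕ) → Fin n → Set where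
      hit : ∀ {ρ̄ d σ q̂ q'} → All (∁ P) ρ̄ → P d →
            Run tst stp q (x ∷ ρ̄ ++ [ d ]) q̂ → Run tst stp q̂ (d ∷ σ) q' →
            FirstHit P q x (ρ̄ ++ d ∷ σ) q'

    first-hit : ∀ {P q x ρ q'} → Decidable P → Run tst stp q (x ∷ ρ) q' →
                All (∁ P) ρ ⊎ FirstHit P q x ρ q'
    first-hit P? done = inj₁ []
    first-hit P? (test t r) =
      Sum.map₂ (λ { (hit a p r₁ r₂) → hit a p (test t r₁) r₂ }) (first-hit P? r)
    first-hit P? (step {u = u} t r) with P? u
    ... | yes p = inj₂ (hit [] p (step t done) r)
    ... | no ¬p =
      Sum.map (¬p ∷_) (λ { (hit a p r₁ r₂) → hit (¬p ∷ a) p (step t r₁) r₂ }) (first-hit P? r)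

  RunOf : (A : NFA NC NR NI) → Fin (states A) → List (List ℕ) → Fin (states A) → Set
  RunOf (nfa _ δ _ _) = Run (testSem δ) (stepSem δ)

  RealisesFromTo : (A : NFA NC NR NI) → Fin (states A) → Fin (states A) → List (List ℕ) → Set
  RealisesFromTo A q q' ρ = All Δ ρ × RunOf A q ρ q'

  realises-sub⇔ : ∀ A q q' ρ → Realises I (sub A q q') ρ ⇔ RealisesFromTo A q q' ρ
  realises-sub⇔ A@(nfa _ _ _ _) q q' ρ = mk⇔
    (λ (a , f , f∈ , r) → a , subst (RunOf A q ρ) (x∈⁅y⁆⇒x≡y q' f∈) r)
    (λ (a , r) → a , q' , x∈⁅x⁆ q' , r)

  exA-sub-⊤⇔ : ∀ A q q' w → Ext I (exA (sub A q q') ⊤c) w ⇔ ∃ λ ρ → RealisesFromTo A q q' (w ∷ ρ)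
  exA-sub-⊤⇔ A q q' w = mk⇔
    (λ e → let ρ , r , _ = to (exA⇔ (sub A q q') ⊤c w) e in ρ , to (realises-sub⇔ A q q' _) r)
    (λ (ρ , r) → from (exA⇔ (sub A q q') ⊤c w)
                   (ρ , from (realises-sub⇔ A q q' _) r , lastOf-All (proj₁ r)))

  RealisesFromTo-++ : ∀ A {q q̂ q' x} ρ {σ} → RealisesFromTo A q q̂ (x ∷ ρ) →
                      RealisesFromTo A q̂ q' (lastOf x ρ ∷ σ) → RealisesFromTo A q q' (x ∷ ρ ++ σ)
  RealisesFromTo-++ (nfa _ _ _ _) ρ (a₁ , r₁) (a₂ , r₂) = ++⁺ a₁ (All.tail a₂) , Run-++ ρ r₁ r₂

module _ {NC NR NI : Set} {I : Interp NC NR NI} {Root : NC} {child edge idR : NR} {NIA NIT : List NI}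
         (qf : QuasiForest I Root child edge idR NIA NIT) where
  open Interp I using (Δ; conc)
  open QuasiForest qf using (root-words; root-named)

  root? : ∀ w → Δ w → Dec (conc Root w)
  root? w Δw with singleton? w
  ... | yes s = yes (from (root-words w) (Δw , s))
  ... | no ¬s = no (¬s ∘ proj₂ ∘ to (root-words w))

  nameless-∷ : ∀ {w ρ} → ¬ conc Root w → All (∁ Singleton) ρ → Nameless I (w ∷ ρ)
  nameless-∷ {w} ¬root ¬singletons =
    ¬root ∘ from (root-named w) ∷ All.map (_∘ named⇒singleton) ¬singletons
    where
    named⇒singleton : ∀ {x} → Sem.Named I x → Singleton x
    named⇒singleton {x} = proj₂ ∘ to (root-words x) ∘ from (root-named x)

  -- Named elements are the roots, i.e. the one-letter words of the domain; unlike being named,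
  -- being a one-letter word is decidable, so the run is split at its first one-letter word.
  nameless-or-outer : ∀ A {q q' w ρ} → RealisesFromTo I A q q' (w ∷ ρ) → ¬ conc Root w →
    Nameless I (w ∷ ρ) ⊎
    ∃₂ λ q̂ ρ₁ → ∃ λ σ → Outer I Root (w ∷ ρ₁) × RealisesFromTo I A q q̂ (w ∷ ρ₁) ×
                        conc Root (lastOf w ρ₁) × RealisesFromTo I A q̂ q' (lastOf w ρ₁ ∷ σ)
  nameless-or-outer A@(nfa _ _ _ _) {q' = q'} {w} (aΔ , r) ¬root with first-hit I singleton? r
  ... | inj₁ ¬singletons = inj₁ (nameless-∷ ¬root ¬singletons)
  ... | inj₂ (hit {ρ̄} {d} {σ} {q̂} ¬singletons sd r₁ r₂) =
    inj₂ (q̂ , ρ̄ ++ [ d ] , σ , (w ∷ ρ̄ , d , refl , (λ ()) , nameless-∷ ¬root ¬singletons , rootd) ,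
          (++⁺ aΔ₁ (All.head aΔ₂ ∷ []) , r₁) ,
          subst (λ e → conc Root e × RealisesFromTo I A q̂ q' (e ∷ σ)) (sym (lastOf-∷ʳ w ρ̄ d))
                (rootd , aΔ₂ , r₂))
    where
    aΔ₁ = proj₁ (++⁻ (w ∷ ρ̄) aΔ)
    aΔ₂ = proj₂ (++⁻ (w ∷ ρ̄) aΔ)
    rootd = from (root-words d) (All.head aΔ₂ , sd)

module Decomposition
  {NC NR NI : Set} {Root : NC} {child edge idR : NR} {NIA NIT : List NI} {I : Interp NC NR NI}
  (qf : QuasiForest I Root child edge idR NIA NIT)
  (A : NFA NC NR NI) (Reach : Fin (states A) → Fin (states A) → NC)
  (Reach⇔ : ∀ q q' w → Ext I (cn (Reach q q')) w ⇔ Ext I (cn Root ⊓ exA (sub A q q') ⊤c) w)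
  (Bn Bo : Fin (states A) → Fin (states A) → NFA NC NR NI)
  (Bn⇔ : ∀ q q' ρ → Realises I (Bn q q') ρ ⇔ (Realises I (sub A q q') ρ × Nameless I ρ))
  (Bo⇔ : ∀ q q' ρ → Realises I (Bo q q') ρ ⇔ (Realises I (sub A q q') ρ × Outer I Root ρ))
  where
  open Interp I using (conc)

  RootReach : Fin (states A) → Fin (states A) → Concept NC NR NI
  RootReach q q' = cn Root ⊓ cn (Reach q q')

  ExitVia : Fin (states A) → Fin (states A) → Fin (states A) → Concept NC NR NI
  ExitVia q q' q̂ = exA (Bo q q̂) (RootReach q̂ q')

  ViaOuter : Fin (states A) → Fin (states A) → Concept NC NR NI
  ViaOuter q q' = ⨆ (map (ExitVia q q') (allFin (states A)))

  Decomposed : Fin (states A) → Fin (states A) → Concept NC NR NI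
  Decomposed q q' = RootReach q q' ⊔ ((¬c (cn Root) ⊓ exA (Bn q q') ⊤c) ⊔ (¬c (cn Root) ⊓ ViaOuter q q'))

  RootReach-intro : ∀ {q q' w ρ} → conc Root w → RealisesFromTo I A q q' (w ∷ ρ) →
                    Ext I (RootReach q q') w
  RootReach-intro {q} {q'} {w} {ρ} root r =
    root , from (Reach⇔ q q' w) (root , from (exA-sub-⊤⇔ I A q q' w) (ρ , r))

  RootReach-elim : ∀ {q q' w} → Ext I (RootReach q q') w → ∃ λ ρ → RealisesFromTo I A q q' (w ∷ ρ)
  RootReach-elim {q} {q'} {w} (_ , reach) =
    to (exA-sub-⊤⇔ I A q q' w) (proj₂ (to (Reach⇔ q q' w) reach))

  Bn-intro : ∀ {q q' w ρ} → RealisesFromTo I A q q' (w ∷ ρ) → Nameless I (w ∷ ρ) →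
             Ext I (exA (Bn q q') ⊤c) w
  Bn-intro {q} {q'} {w} {ρ} r nameless = from (exA⇔ I (Bn q q') ⊤c w)
    (ρ , from (Bn⇔ q q' _) (from (realises-sub⇔ I A q q' _) r , nameless) , lastOf-All (proj₁ r))

  Bn-elim : ∀ {q q' w} → Ext I (exA (Bn q q') ⊤c) w → Ext I (exA (sub A q q') ⊤c) w
  Bn-elim {q} {q'} {w} e =
    let ρ , r , top = to (exA⇔ I (Bn q q') ⊤c w) e
    in from (exA⇔ I (sub A q q') ⊤c w) (ρ , proj₁ (to (Bn⇔ q q' _) r) , top)

  ViaOuter-intro : ∀ {q q̂ q' w ρ} → Outer I Root (w ∷ ρ) → RealisesFromTo I A q q̂ (w ∷ ρ) →
                   Ext I (RootReach q̂ q') (lastOf w ρ) → Ext I (ViaOuter q q') w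
  ViaOuter-intro {q} {q̂} {q'} {w} {ρ} outer r reach =
    from (⨆-allFin⇔∃ I (ExitVia q q') w)
      (q̂ , from (exA⇔ I (Bo q q̂) _ w)
             (ρ , from (Bo⇔ q q̂ _) (from (realises-sub⇔ I A q q̂ _) r , outer) , reach))

  ViaOuter-elim : ∀ {q q' w} → Ext I (ViaOuter q q') w → ∃ λ ρ → RealisesFromTo I A q q' (w ∷ ρ)
  ViaOuter-elim {q} {q'} {w} e =
    let q̂ , e′ = to (⨆-allFin⇔∃ I (ExitVia q q') w) e
        ρ , r , reach = to (exA⇔ I (Bo q q̂) _ w) e′
        σ , r′ = RootReach-elim reach
    in ρ ++ σ , RealisesFromTo-++ I A ρ (to (realises-sub⇔ I A q q̂ _) (proj₁ (to (Bo⇔ q q̂ _) r))) r′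

  decompose : ∀ {q q' w ρ} → RealisesFromTo I A q q' (w ∷ ρ) → Dec (conc Root w) →
              Ext I (Decomposed q q') w
  decompose r (yes root) = inj₁ (RootReach-intro root r)
  decompose r@(Δw ∷ _ , _) (no ¬root) = inj₂ (Sum.map
    (λ nameless → (Δw , ¬root) , Bn-intro r nameless)
    (λ (_ , _ , _ , outer , r₁ , root , r₂) →
       (Δw , ¬root) , ViaOuter-intro outer r₁ (RootReach-intro root r₂))
    (nameless-or-outer qf A r ¬root))

  complete : ∀ q q' w → Ext I (exA (sub A q q') ⊤c) w → Ext I (Decomposed q q') w
  complete q q' w e =
    let _ , r = to (exA-sub-⊤⇔ I A q q' w) e in decompose r (root? qf w (All.head (proj₁ r)))

  sound : ∀ q q' w → Ext I (Decomposed q q') w → Ext I (exA (sub A q q') ⊤c) w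
  sound q q' w (inj₁ (_ , reach))    = proj₂ (to (Reach⇔ q q' w) reach)
  sound q q' w (inj₂ (inj₁ (_ , e))) = Bn-elim e
  sound q q' w (inj₂ (inj₂ (_ , e))) = from (exA-sub-⊤⇔ I A q q' w) (ViaOuter-elim e)

lemma5 : {NC NR NI : Set} (Root : NC) (child edge idR : NR) (NIA NIT : List NI)
    (I : Interp NC NR NI) → QuasiForest I Root child edge idR NIA NIT →
    (A : NFA NC NR NI) (Reach : Fin (states A) → Fin (states A) → NC) →
    (∀ q q' w → Ext I (cn (Reach q q')) w ⇔ Ext I (cn Root ⊓ exA (sub A q q') ⊤c) w) →
    (Bn Bo : Fin (states A) → Fin (states A) → NFA NC NR NI) →
    (∀ q q' ρ → Realises I (Bn q q') ρ ⇔ (Realises I (sub A q q') ρ × Nameless I ρ)) →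
    (∀ q q' ρ → Realises I (Bo q q') ρ ⇔ (Realises I (sub A q q') ρ × Outer I Root ρ)) →
    ∀ q q' w → Ext I (exA (sub A q q') ⊤c) w ⇔
      Ext I ((cn Root ⊓ cn (Reach q q'))
             ⊔ ((¬c (cn Root) ⊓ exA (Bn q q') ⊤c)
             ⊔ (¬c (cn Root) ⊓ ⨆ (map (λ q̂ → exA (Bo q q̂) (cn Root ⊓ cn (Reach q̂ q'))) (allFin (states A)))))) w
lemma5 Root child edge idR NIA NIT I qf A Reach Reach⇔ Bn Bo Bn⇔ Bo⇔ q q' w =
  mk⇔ (complete q q' w) (sound q q' w)
  where open Decomposition qf A Reach Reach⇔ Bn Bo Bn⇔ Bo⇔
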